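{- Let $X$ be a countable set. If $\mathcal{F}$ is a filter of countable type on $X$, then either $\mathcal{F}$ is $\omega$-diagonalizable, or $\mathcal{F}=\mathcal{F}_A$ for some finite set $A\subset X$.
   Context: The family of filters of countable type on $X$ is the smallest class of filters on $X$ containing all principal ultrafilters $\{M\subset X:x\in M\}$ ($x\in X$) and closed under countable intersections and unions of increasing sequences of filters. For $E\subset X$, $\mathcal{F}_E=\{M\subset X:E\subset M\}$. A filter $\mathcal{F}$ is $\omega$-diagonalizable if there is a countable family $\{A_n:n\in\omega\}$ of infinite sets such that for every $M\in\mathcal{F}$ there is $n$ with $A_n\subset M$. -}

module Defs where

open import Level using (0ℓ)
open import Data.Nat using (ℕ; suc)
open import Data.Product using (Σ; ∃; _×_)
open import Data.List using (List)
open import Data.List.Membership.Propositional using () renaming (_∈_ to _∈ₗ_)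
open import Relation.Nullary using (¬_)
open import Relation.Unary using (Pred; _⊆_)
open import Function.Bundles using (_↣_; _⇔_)

Subset : Set → Set₁
Subset X = Pred X 0ℓ

Family : Set → Set₁
Family X = Pred (Subset X) 0ℓ

Countable : Set → Set
Countable X = X ↣ ℕ

Finite : {X : Set} → Subset X → Set
Finite {X} S = Σ (List X) λ l → ∀ x → S x → x ∈ₗ l

Infinite : {X : Set} → Subset X → Set
Infinite S = ¬ Finite S

principalUF : {X : Set} → X → Family X
principalUF x M = M x

F[_] : {X : Set} → List X → Family X
F[_] {X} A M = ∀ x → x ∈ₗ A → M x

data CountableType {X : Set} : Family X → Set₁ where
  principal : (x : X) → CountableType (principalUF x)
  ⋂-closed  : (Fs : ℕ → Family X) → (∀ n → CountableType (Fs n)) →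
              CountableType (λ M → ∀ n → Fs n M)
  ⋃-closed  : (Fs : ℕ → Family X) → (∀ n → CountableType (Fs n)) →
              (∀ n → Fs n ⊆ Fs (suc n)) →
              CountableType (λ M → ∃ λ n → Fs n M)

ωDiagonalizable : {X : Set} → Family X → Set₁
ωDiagonalizable {X} F =
  Σ (ℕ → Subset X) λ A → (∀ n → Infinite (A n)) ×
    (∀ M → F M → ∃ λ n → A n ⊆ M)

_≐_ : {X : Set} → Family X → Family X → Set₁
F ≐ G = ∀ M → F M ⇔ G M

module Submission where

-- Induction on the derivation that F is of countable type,
-- proving at every stage the dichotomy "F is ω-diagonalizable, or F = F[ A ]
-- for a finite list A".
--   * A principal ultrafilter at x is F[ x ].
--   * Intersection ⋂ Fs: if some Fs n is diagonalizable, so is the smaller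
--     ⋂ Fs.  Otherwise Fs n = F[ E n ] for all n, and ⋂ Fs consists of the
--     supersets of U = ⋃ E n; this is F[ U ] when U is finite, and is
--     diagonalized by the constant sequence U when U is infinite.
--   * Increasing union ⋃ Fs: if every Fs n is diagonalizable, interleave the
--     diagonalizing sequences along an enumeration of ℕ × ℕ.  Otherwise
--     Fs N = F[ E ] for some N; the larger filters Fs j (j ≥ N) contain the
--     finite set E, so none is diagonalizable and each is F[ E j ] with E j
--     decreasing in j.  Such a decreasing sequence of finite sets stabilizes
--     (classically), so the union is F[ ⋂ E j ].

open import Defs
open import Level using (Level; 0ℓ)
open import Axiom.ExcludedMiddle using (ExcludedMiddle)
open import Data.Nat using (ℕ; zero; suc; _+_; _⊔_; _≤_; _≤′_; ≤′-reflexive; ≤′-step; z≤n)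
open import Data.Nat.Properties using (+-suc; +-identityʳ; ≤⇒≤′; m≤m+n; m≤n+m; m≤m⊔n; m≤n⊔m)
open import Data.Product using (Σ; ∃; _×_; _,_; proj₁; proj₂)
open import Data.Sum using (_⊎_; inj₁; inj₂; fromInj₂; swap)
open import Data.Bool using (Bool; true; false; T)
open import Data.Empty using (⊥-elim)
open import Data.List using (List; []; _∷_; [_]; filter)
open import Data.List.Membership.Propositional using (_∈_)
open import Data.List.Membership.Propositional.Properties using (∈-filter⁺; ∈-filter⁻)
open import Data.List.Relation.Unary.Any using (here; there)
open import Relation.Nullary using (¬_; yes; no)
open import Relation.Unary using (_⊆_)
open import Relation.Binary.PropositionalEquality using (_≡_; refl; sym; trans; cong)
open import Function.Bundles using (_⇔_; mk⇔; Equivalence)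
open Equivalence using (to; from)

-- An enumeration of ℕ × ℕ walking along the anti-diagonals:
-- (a , b+1) is followed by (a+1 , b), and (a , 0) by (0 , a+1).
next : ℕ × ℕ → ℕ × ℕ
next (a , suc b) = (suc a , b)
next (a , zero)  = (zero , suc a)

unpair : ℕ → ℕ × ℕ
unpair zero    = (zero , zero)
unpair (suc k) = next (unpair k)

walk : ∀ a b k → unpair k ≡ (zero , a + b) → unpair (a + k) ≡ (a , b)
walk zero    b k h = h
walk (suc a) b k h = cong next (walk a (suc b) k (trans h (cong (zero ,_) (sym (+-suc a b)))))

diagonal-start : ∀ s → ∃ λ k → unpair k ≡ (zero , s)
diagonal-start zero    = zero , refl
diagonal-start (suc s) with diagonal-start s
... | k , h = suc (s + k) , cong next (walk s zero k (trans h (cong (zero ,_) (sym (+-identityʳ s)))))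

unpair-surjective : ∀ a b → ∃ λ k → unpair k ≡ (a , b)
unpair-surjective a b with diagonal-start (a + b)
... | k , h = a + k , walk a b k h

isLeft : {a b : Level} {A : Set a} {B : Set b} → A ⊎ B → Bool
isLeft (inj₁ _) = true
isLeft (inj₂ _) = false

fromLeft : {a b : Level} {A : Set a} {B : Set b} (e : A ⊎ B) → T (isLeft e) → A
fromLeft (inj₁ a) _ = a

fromRight : {a b : Level} {A : Set a} {B : Set b} (e : A ⊎ B) → ¬ T (isLeft e) → B
fromRight (inj₁ _) ¬left = ⊥-elim (¬left _)
fromRight (inj₂ b) _     = b

module _ (em : ExcludedMiddle 0ℓ) where

  ¬∀⇒∃¬ : {P : ℕ → Set} → ¬ (∀ n → P n) → ∃ λ n → ¬ P n
  ¬∀⇒∃¬ {P} ¬∀ with em {∃ λ n → ¬ P n}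
  ... | yes ∃¬ = ∃¬
  ... | no ¬∃¬ = ⊥-elim (¬∀ holds)
    where
      holds : ∀ n → P n
      holds n with em {P n}
      ... | yes p  = p
      ... | no ¬p  = ⊥-elim (¬∃¬ (n , ¬p))

  -- Excluded middle is only available for small
  -- propositions, so it is applied to the Boolean test "d n is a left
  -- injection".
  some-or-all : {a b : Level} {A : ℕ → Set a} {B : ℕ → Set b} → (∀ n → A n ⊎ B n) → (∃ λ n → A n) ⊎ (∀ n → B n)
  some-or-all d with em {∃ λ n → T (isLeft (d n))}
  ... | yes (n , left) = inj₁ (n , fromLeft (d n) left)
  ... | no ¬left       = inj₂ λ n → fromRight (d n) (λ left → ¬left (n , left))

module _ {X : Set} where

  ⋂ᶠ : (ℕ → Family X) → Family X
  ⋂ᶠ Fs M = ∀ n → Fs n M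

  ⋃ᶠ : (ℕ → Family X) → Family X
  ⋃ᶠ Fs M = ∃ λ n → Fs n M

  Increasing : (ℕ → Family X) → Set₁
  Increasing Fs = ∀ n → Fs n ⊆ Fs (suc n)

  FinitelyGenerated : Family X → Set₁
  FinitelyGenerated F = Σ (List X) λ A → F ≐ F[ A ]

  Dichotomy : Family X → Set₁
  Dichotomy F = ωDiagonalizable F ⊎ FinitelyGenerated F

  Lists : List X → Subset X → Set
  Lists L S = ∀ x → x ∈ L ⇔ S x

  ≐-trans : {F G H : Family X} → F ≐ G → G ≐ H → F ≐ H
  ≐-trans F≐G G≐H M = mk⇔ (λ f → to (G≐H M) (to (F≐G M) f)) (λ h → from (F≐G M) (from (G≐H M) h))

  increasing⇒monotone : {Fs : ℕ → Family X} → Increasing Fs → ∀ {m n} → m ≤ n → Fs m ⊆ Fs n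
  increasing⇒monotone {Fs} inc m≤n = go (≤⇒≤′ m≤n)
    where
      go : ∀ {m n} → m ≤′ n → Fs m ⊆ Fs n
      go (≤′-reflexive refl) F = F
      go (≤′-step m≤′n)      F = inc _ (go m≤′n F)

  ⋃-shift : {Fs : ℕ → Family X} → Increasing Fs → ∀ N → ⋃ᶠ Fs ≐ ⋃ᶠ (λ j → Fs (j + N))
  ⋃-shift inc N M = mk⇔ (λ { (n , F) → n , increasing⇒monotone inc (m≤m+n n N) F })
                        (λ { (j , F) → j + N , F })

  F[]-of-listed : {L : List X} {S : Subset X} → Lists L S → ∀ M → F[ L ] M ⇔ (S ⊆ M)
  F[]-of-listed {S = S} L≗S M = mk⇔ (λ L⊆M {x} s → L⊆M x (from (L≗S x) s))
                                    (λ (S⊆M : S ⊆ M) x x∈L → S⊆M (to (L≗S x) x∈L))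

  F[]-reflects-⊆ : {A B : List X} → F[ A ] ⊆ F[ B ] → (_∈ B) ⊆ (_∈ A)
  F[]-reflects-⊆ {A} FA⊆FB {x} = FA⊆FB (λ _ x∈A → x∈A) x

  principal-finGen : (x : X) → principalUF x ≐ F[ [ x ] ]
  principal-finGen x M = mk⇔ (λ { Mx _ (here refl) → Mx }) (λ FM → FM x (here refl))

  -- A filter containing a finite set is not diagonalizable: its members
  -- include that finite set, which has no infinite subset.
  finGen⇒¬diag : {E : List X} {G : Family X} → F[ E ] ⊆ G → ¬ ωDiagonalizable G
  finGen⇒¬diag {E} FE⊆G (A , infinite , cover) with cover (_∈ E) (FE⊆G (λ _ x∈E → x∈E))
  ... | n , An⊆E = infinite n (E , λ _ x∈An → An⊆E x∈An)

  diag-antitone : {F G : Family X} → G ⊆ F → ωDiagonalizable F → ωDiagonalizable G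
  diag-antitone G⊆F (A , infinite , cover) = A , infinite , λ M GM → cover M (G⊆F GM)

  -- A union of countably many diagonalizable filters is diagonalizable: the
  -- k-th set is the (unpair k)-th entry of the doubly indexed family.
  ⋃-diag : (Fs : ℕ → Family X) → (∀ n → ωDiagonalizable (Fs n)) → ωDiagonalizable (⋃ᶠ Fs)
  ⋃-diag Fs diag = A , infinite , cover
    where
      A : ℕ → Subset X
      A k = proj₁ (diag (proj₁ (unpair k))) (proj₂ (unpair k))
      infinite : ∀ k → Infinite (A k)
      infinite k = proj₁ (proj₂ (diag (proj₁ (unpair k)))) (proj₂ (unpair k))
      cover : ∀ M → ⋃ᶠ Fs M → ∃ λ k → A k ⊆ M
      cover M (n , FnM) with proj₂ (proj₂ (diag n)) M FnM
      ... | i , Ani⊆M with unpair-surjective n i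
      ... | k , refl = k , Ani⊆M

  ⋂F[]-listed : {Fs : ℕ → Family X} {E : ℕ → List X} {L : List X} →
    (∀ n → Fs n ≐ F[ E n ]) → Lists L (λ x → ∃ λ n → x ∈ E n) → ⋂ᶠ Fs ≐ F[ L ]
  ⋂F[]-listed Fs≐ L≗U M = mk⇔
    (λ ⋂M → from (F[]-of-listed L≗U M) λ { (n , x∈En) → to (Fs≐ n M) (⋂M n) _ x∈En })
    (λ FLM n → from (Fs≐ n M) λ x x∈En → to (F[]-of-listed L≗U M) FLM (n , x∈En))

  -- If ⋃ E n is infinite, that single set diagonalizes the intersection.
  ⋂F[]-diag : {Fs : ℕ → Family X} {E : ℕ → List X} →
    (∀ n → Fs n ≐ F[ E n ]) → Infinite (λ x → ∃ λ n → x ∈ E n) → ωDiagonalizable (⋂ᶠ Fs)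
  ⋂F[]-diag Fs≐ infinite = (λ _ → _) , (λ _ → infinite) ,
    λ M ⋂M → zero , λ { (n , x∈En) → to (Fs≐ n M) (⋂M n) _ x∈En }

module _ (em : ExcludedMiddle 0ℓ) {X : Set} where

  -- Classically, a finite subset is enumerated exactly by some list: filter
  -- any list covering it.
  finite⇒listed : {S : Subset X} → Finite S → Σ (List X) λ L → Lists L S
  finite⇒listed {S} (l , covers) = filter (λ x → em {S x}) l , λ x →
    mk⇔ (λ x∈L → proj₂ (∈-filter⁻ (λ x → em {S x}) {xs = l} x∈L))
        (λ Sx → ∈-filter⁺ (λ x → em {S x}) (covers x Sx) Sx)

  -- For each element of E 0 outside the
  -- intersection choose a stage where it has left, and take the maximum.
  stabilizes : (E : ℕ → List X) → (∀ {j k} → j ≤ k → (_∈ E k) ⊆ (_∈ E j)) →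
    ∃ λ m → (_∈ E m) ⊆ (λ x → ∀ j → x ∈ E j)
  stabilizes E decreasing with stabilizes-on (E zero)
    where
      stabilizes-on : (l : List X) → ∃ λ m → ∀ {x} → x ∈ l → x ∈ E m → ∀ j → x ∈ E j
      stabilizes-on []      = zero , λ ()
      stabilizes-on (y ∷ l) with stabilizes-on l | em {∀ j → y ∈ E j}
      ... | m , stable | yes y∈⋂ = m , λ { (here refl) _ → y∈⋂ ; (there x∈l) → stable x∈l }
      ... | m , stable | no y∉⋂ with ¬∀⇒∃¬ em y∉⋂
      ... | j , y∉Ej = m ⊔ j , λ
        { (here refl) y∈E → ⊥-elim (y∉Ej (decreasing (m≤n⊔m m j) y∈E))
        ; (there x∈l) x∈E → stable x∈l (decreasing (m≤m⊔n m j) x∈E) }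
  ... | m , stable = m , λ x∈Em → stable (decreasing z≤n x∈Em) x∈Em

  -- An increasing union of finitely generated filters F[ E j ] is generated
  -- by the intersection of the E j, which is finite as a subset of E 0.
  increasing-⋃-finGen : {Gs : ℕ → Family X} {E : ℕ → List X} → Increasing Gs →
    (∀ j → Gs j ≐ F[ E j ]) → FinitelyGenerated (⋃ᶠ Gs)
  increasing-⋃-finGen {Gs} {E} inc Gs≐ with finite⇒listed {S = ⋂E} (E zero , λ _ x∈⋂ → x∈⋂ zero)
                                           | stabilizes E decreasing
    where
      ⋂E : Subset X
      ⋂E x = ∀ j → x ∈ E j
      decreasing : ∀ {j k} → j ≤ k → (_∈ E k) ⊆ (_∈ E j)
      decreasing {j} {k} j≤k = F[]-reflects-⊆ λ {M} FjM →
        to (Gs≐ k M) (increasing⇒monotone inc j≤k (from (Gs≐ j M) FjM))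
  ... | L , L≗⋂E | m , Em⊆⋂E = L , λ M → mk⇔
    (λ { (j , GjM) → from (F[]-of-listed L≗⋂E M) λ x∈⋂ → to (Gs≐ j M) GjM _ (x∈⋂ j) })
    (λ FLM → m , from (Gs≐ m M) λ x x∈Em → to (F[]-of-listed L≗⋂E M) FLM (Em⊆⋂E x∈Em))

  ⋂-dichotomy : (Fs : ℕ → Family X) → (∀ n → Dichotomy (Fs n)) → Dichotomy (⋂ᶠ Fs)
  ⋂-dichotomy Fs dich with some-or-all em dich
  ... | inj₁ (n , diag) = inj₁ (diag-antitone (λ ⋂M → ⋂M n) diag)
  ... | inj₂ finGen with em {Finite (λ x → ∃ λ n → x ∈ proj₁ (finGen n))}
  ... | yes finite with finite⇒listed finite
  ...   | L , L≗U = inj₂ (L , ⋂F[]-listed (λ n → proj₂ (finGen n)) L≗U)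
  ⋂-dichotomy Fs dich | inj₂ finGen | no infinite = inj₁ (⋂F[]-diag (λ n → proj₂ (finGen n)) infinite)

  -- Increasing-union case: all members diagonalizable, or from some stage N
  -- on all members contain a fixed finite set, hence are finitely generated.
  ⋃-dichotomy : (Fs : ℕ → Family X) → Increasing Fs → (∀ n → Dichotomy (Fs n)) →
    Dichotomy (⋃ᶠ Fs)
  ⋃-dichotomy Fs inc dich with some-or-all em (λ n → swap (dich n))
  ... | inj₂ diag = inj₁ (⋃-diag Fs diag)
  ... | inj₁ (N , E , FN≐) with increasing-⋃-finGen {Gs = λ j → Fs (j + N)} (λ j → inc (j + N))
                                                      (λ j → proj₂ (later-finGen j))
    where
      later-finGen : ∀ j → FinitelyGenerated (Fs (j + N))
      later-finGen j = fromInj₂ (λ diag → ⊥-elim (finGen⇒¬diag contains-E diag)) (dich (j + N))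
        where
          contains-E : F[ E ] ⊆ Fs (j + N)
          contains-E {M} FEM = increasing⇒monotone inc (m≤n+m N j) (from (FN≐ M) FEM)
  ... | L , ⋃≐ = inj₂ (L , ≐-trans (⋃-shift inc N) ⋃≐)

  dichotomy : (F : Family X) → CountableType F → Dichotomy F
  dichotomy _ (principal x)          = inj₂ ([ x ] , principal-finGen x)
  dichotomy _ (⋂-closed Fs cts)      = ⋂-dichotomy Fs (λ n → dichotomy (Fs n) (cts n))
  dichotomy _ (⋃-closed Fs cts inc)  = ⋃-dichotomy Fs inc (λ n → dichotomy (Fs n) (cts n))

proposition5p1 : ExcludedMiddle 0ℓ → (X : Set) → Countable X →
    (F : Family X) → CountableType F →
    ωDiagonalizable F ⊎ Σ (List X) (λ A → F ≐ F[ A ])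
proposition5p1 em X _ = dichotomy em
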